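{- Let $P$ be a finite poset, let $G$ be the cover graph of $P$, and let $Q$ be the incidence poset of $G$. Then $\dim(Q)\le 2\dim(P)$.
   Context: For a poset $P$ and $x,y\in P$ with $x>y$, we say $x$ covers $y$ if there is no $z$ with $x>z>y$; the cover graph of $P$ has vertex set $P$, with $\{x,y\}$ an edge when one of $x,y$ covers the other. For a graph $G=(V,E)$, the incidence poset of $G$ has ground set $V\cup E$ ordered by inclusion (edges regarded as $2$-element subsets of $V$): vertices are minimal, edges are maximal, and a vertex is below an edge exactly when it is an endpoint of that edge. The dimension $\dim(R)$ of a poset $R$ is the minimum number of linear extensions of $R$ whose intersection is $R$ (i.e., $x<y$ in $R$ iff $x<y$ in each of them). -}

module Defs where

open import Data.Nat using (ℕ) renaming (_≤_ to _≤ℕ_)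
open import Data.Fin using (Fin)
open import Data.Sum using (_⊎_; inj₁; inj₂)
open import Data.Product using (Σ; _×_; _,_; ∃-syntax)
open import Data.Empty using (⊥)
open import Relation.Nullary using (¬_)
open import Relation.Binary.Core using (Rel)
open import Relation.Binary.Structures using (IsTotalOrder)
open import Relation.Binary.PropositionalEquality using (_≡_; _≢_)
open import Level using (0ℓ)

record LinearExtension {A : Set} (_≈_ : Rel A 0ℓ) (_≤_ : Rel A 0ℓ) : Set₁ where
  field
    _⊑_          : Rel A 0ℓ
    isTotalOrder : IsTotalOrder _≈_ _⊑_
    extends      : ∀ {x y} → x ≤ y → x ⊑ y

-- A realizer of size d: d linear extensions whose intersection is _≤_
-- (the inclusion ≤ ⊆ ⋂ Lᵢ is built into LinearExtension).
Realizer : {A : Set} (_≈_ : Rel A 0ℓ) (_≤_ : Rel A 0ℓ) → ℕ → Set₁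
Realizer {A} _≈_ _≤_ d =
  Σ (Fin d → LinearExtension _≈_ _≤_) λ L →
    ∀ x y → (∀ i → LinearExtension._⊑_ (L i) x y) → x ≤ y

IsDimension : {A : Set} (_≈_ : Rel A 0ℓ) (_≤_ : Rel A 0ℓ) → ℕ → Set₁
IsDimension _≈_ _≤_ d =
  Realizer _≈_ _≤_ d × (∀ k → Realizer _≈_ _≤_ k → d ≤ℕ k)

-- Finite posets are given on carrier Fin n with equality _≡_ and an
-- order relation _≤P_ (a partial order, assumed in the statement).

module _ {n : ℕ} (_≤P_ : Rel (Fin n) 0ℓ) where

  _<P_ : Rel (Fin n) 0ℓ
  x <P y = x ≤P y × x ≢ y

  Covers : Rel (Fin n) 0ℓ
  Covers x y = (y <P x) × ¬ (∃[ z ] (y <P z × z <P x))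

  -- Edges of the cover graph: each edge {x,y} is recorded once, as the
  -- ordered pair (x , y) with x covering y.
  CoverEdge : Set
  CoverEdge = Σ (Fin n × Fin n) λ { (x , y) → Covers x y }

  IncElem : Set
  IncElem = Fin n ⊎ CoverEdge

  _≈Q_ : Rel IncElem 0ℓ
  inj₁ v ≈Q inj₁ w = v ≡ w
  inj₁ _ ≈Q inj₂ _ = ⊥
  inj₂ _ ≈Q inj₁ _ = ⊥
  inj₂ ((x , y) , _) ≈Q inj₂ ((x' , y') , _) = x ≡ x' × y ≡ y'

  _≤Q_ : Rel IncElem 0ℓ
  inj₁ v ≤Q inj₁ w = v ≡ w
  inj₁ v ≤Q inj₂ ((x , y) , _) = v ≡ x ⊎ v ≡ y
  inj₂ _ ≤Q inj₁ _ = ⊥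
  inj₂ e ≤Q inj₂ f = inj₂ e ≈Q inj₂ f

-- Each linear extension L of P yields two linear extensions of Q.  Send a vertex v
-- to the interval [v, v] of P and an edge in which x covers y to [y, x]; the first
-- extension sorts Q by top endpoint along L (an edge right after its top), the second
-- by bottom endpoint along the reverse of L (an edge right after its bottom in that
-- reversed order).  If a precedes b in all 2 dim(P) of them, the interval of a lies
-- inside the interval of b, and since a covering pair has nothing strictly between
-- its endpoints, this containment forces a ≤ b in Q.
module Submission where

open import Defs
open import Data.Nat using (ℕ; _≤_; _*_; z≤n)
open import Data.Fin using (Fin; zero; suc; _↑ˡ_; _↑ʳ_) renaming (_≤_ to _≤F_)
import Data.Fin.Properties as Finₚ
open import Data.Vec.Functional using (Vector; _++_; [])
open import Data.Vec.Functional.Properties using (lookup-++ˡ; lookup-++ʳ)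
open import Data.Product using (_×_; _,_; proj₁; proj₂)
open import Data.Product.Relation.Binary.Pointwise.NonDependent using (Pointwise)
open import Data.Product.Relation.Binary.Lex.NonStrict using (×-Lex; ×-isTotalOrder)
open import Data.Sum using (_⊎_; inj₁; inj₂)
open import Data.Empty using (⊥-elim)
open import Function using (_∘_; flip)
open import Relation.Nullary using (yes; no)
open import Relation.Binary.Core using (Rel)
open import Relation.Binary.Definitions using (Reflexive; DecidableEquality)
open import Relation.Binary.Structures using (IsPartialOrder; IsTotalOrder)
open import Relation.Binary.PropositionalEquality using (_≡_; refl; sym; subst)
import Relation.Binary.Construct.Flip.EqAndOrd as Flip
open import Level using (0ℓ)

open LinearExtension using (_⊑_)

isTotalOrder-on : {A B : Set} {_≈_ : Rel A 0ℓ} {_≈B_ _≤B_ : Rel B 0ℓ} (key : A → B) →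
                  (∀ {a b} → a ≈ b → key a ≈B key b) → (∀ {a b} → key a ≈B key b → a ≈ b) →
                  IsTotalOrder _≈B_ _≤B_ → IsTotalOrder _≈_ (λ a b → key a ≤B key b)
isTotalOrder-on key to from T = record
  { isPartialOrder = record
    { isPreorder = record
      { isEquivalence = record
        { refl  = from T.Eq.refl
        ; sym   = λ e → from (T.Eq.sym (to e))
        ; trans = λ e f → from (T.Eq.trans (to e) (to f)) }
      ; reflexive = T.reflexive ∘ to
      ; trans     = T.trans }
    ; antisym = λ p q → from (T.antisym p q) }
  ; total = λ a b → T.total (key a) (key b) }
  where module T = IsTotalOrder T

Realizer-++ : {A : Set} {_≈_ _≤_ : Rel A 0ℓ} {d : ℕ} (L L′ : Vector (LinearExtension _≈_ _≤_) d) →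
              (∀ x y → (∀ i → _⊑_ (L i) x y) → (∀ i → _⊑_ (L′ i) x y) → x ≤ y) →
              Realizer _≈_ _≤_ (2 * d)
Realizer-++ {d = d} L L′ realizes = L ++ (L′ ++ []) , λ x y h →
  realizes x y
    (λ i → subst (λ K → _⊑_ K x y) (lookup-++ˡ L (L′ ++ []) i) (h (i ↑ˡ _)))
    (λ i → subst (λ K → _⊑_ K x y) (lookup-++ˡ L′ [] i)
             (subst (λ K → _⊑_ K x y) (lookup-++ʳ L (L′ ++ []) (i ↑ˡ 0)) (h (d ↑ʳ (i ↑ˡ 0)))))

module _ {A : Set} where

  Key : Set
  Key = A × Fin 2 × A

  _≋_ : Rel Key 0ℓ
  _≋_ = Pointwise _≡_ (Pointwise _≡_ _≡_)

  Lex : Rel A 0ℓ → Rel Key 0ℓ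
  Lex R = ×-Lex _≡_ R (×-Lex _≡_ _≤F_ R)

  Lex-isTotalOrder : DecidableEquality A → {R : Rel A 0ℓ} →
                     IsTotalOrder _≡_ R → IsTotalOrder _≋_ (Lex R)
  Lex-isTotalOrder _≟_ T = ×-isTotalOrder _≟_ T (×-isTotalOrder Finₚ._≟_ Finₚ.≤-isTotalOrder T)

  Lex-head : {R : Rel A 0ℓ} → Reflexive R → ∀ {x s y t} → Lex R (x , s) (y , t) → R x y
  Lex-head _      (inj₁ (r , _))    = r
  Lex-head refl-R (inj₂ (refl , _)) = refl-R

  Lex-last : {R : Rel A 0ℓ} → ∀ {x t y y′} → Lex R (x , t , y) (x , t , y′) → R y y′
  Lex-last (inj₁ (_ , x≢x))            = ⊥-elim (x≢x refl)
  Lex-last (inj₂ (_ , inj₁ (_ , t≢t))) = ⊥-elim (t≢t refl)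
  Lex-last (inj₂ (_ , inj₂ (_ , r)))   = r

module _ {n : ℕ} {_≤P_ : Rel (Fin n) 0ℓ} where

  private
    Q       = IncElem _≤P_
    _≈Q′_   = _≈Q_ _≤P_
    _≤Q′_   = _≤Q_ _≤P_

  top bottom : Q → Fin n
  top    (inj₁ v)             = v
  top    (inj₂ ((x , _) , _)) = x
  bottom (inj₁ v)             = v
  bottom (inj₂ ((_ , y) , _)) = y

  tag : Q → Fin 2
  tag (inj₁ _) = zero
  tag (inj₂ _) = suc zero

  topKey bottomKey : Q → Key
  topKey    a = top a , tag a , bottom a
  bottomKey a = bottom a , tag a , top a

  ≈Q⇒topKey≋ : ∀ {a b} → a ≈Q′ b → topKey a ≋ topKey b
  ≈Q⇒topKey≋ {inj₁ _} {inj₁ _} refl          = refl , refl , refl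
  ≈Q⇒topKey≋ {inj₂ _} {inj₂ _} (refl , refl) = refl , refl , refl

  topKey≋⇒≈Q : ∀ {a b} → topKey a ≋ topKey b → a ≈Q′ b
  topKey≋⇒≈Q {inj₁ _} {inj₁ _} (e , _)     = e
  topKey≋⇒≈Q {inj₁ _} {inj₂ _} (_ , () , _)
  topKey≋⇒≈Q {inj₂ _} {inj₁ _} (_ , () , _)
  topKey≋⇒≈Q {inj₂ _} {inj₂ _} (e , _ , f) = e , f

  ≈Q⇒bottomKey≋ : ∀ {a b} → a ≈Q′ b → bottomKey a ≋ bottomKey b
  ≈Q⇒bottomKey≋ {inj₁ _} {inj₁ _} refl          = refl , refl , refl
  ≈Q⇒bottomKey≋ {inj₂ _} {inj₂ _} (refl , refl) = refl , refl , refl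

  bottomKey≋⇒≈Q : ∀ {a b} → bottomKey a ≋ bottomKey b → a ≈Q′ b
  bottomKey≋⇒≈Q {inj₁ _} {inj₁ _} (e , _)     = e
  bottomKey≋⇒≈Q {inj₁ _} {inj₂ _} (_ , () , _)
  bottomKey≋⇒≈Q {inj₂ _} {inj₁ _} (_ , () , _)
  bottomKey≋⇒≈Q {inj₂ _} {inj₂ _} (e , _ , f) = f , e

  byTop : LinearExtension _≡_ _≤P_ → LinearExtension _≈Q′_ _≤Q′_
  byTop L = record
    { _⊑_          = λ a b → Lex _⊑ᴸ_ (topKey a) (topKey b)
    ; isTotalOrder = total
    ; extends      = extends′ }
    where
    open LinearExtension L using (isTotalOrder; extends) renaming (_⊑_ to _⊑ᴸ_)
    total : IsTotalOrder _≈Q′_ (λ a b → Lex _⊑ᴸ_ (topKey a) (topKey b))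
    total = isTotalOrder-on topKey ≈Q⇒topKey≋ topKey≋⇒≈Q (Lex-isTotalOrder Finₚ._≟_ isTotalOrder)
    extends′ : ∀ {a b} → a ≤Q′ b → Lex _⊑ᴸ_ (topKey a) (topKey b)
    extends′ {a@(inj₁ _)} {b@(inj₁ _)} a≈b               = IsTotalOrder.reflexive total {a} {b} a≈b
    extends′ {a@(inj₂ _)} {b@(inj₂ _)} a≈b               = IsTotalOrder.reflexive total {a} {b} a≈b
    extends′ {inj₁ _} {inj₂ _} (inj₁ refl)               = inj₂ (refl , inj₁ (z≤n , λ ()))
    extends′ {inj₁ _} {inj₂ (_ , (y<x , _))} (inj₂ refl) = inj₁ (extends (proj₁ y<x) , proj₂ y<x)

  byBottom : LinearExtension _≡_ _≤P_ → LinearExtension _≈Q′_ _≤Q′_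
  byBottom L = record
    { _⊑_          = λ a b → Lex (flip _⊑ᴸ_) (bottomKey a) (bottomKey b)
    ; isTotalOrder = total
    ; extends      = extends′ }
    where
    open LinearExtension L using (isTotalOrder; extends) renaming (_⊑_ to _⊑ᴸ_)
    total : IsTotalOrder _≈Q′_ (λ a b → Lex (flip _⊑ᴸ_) (bottomKey a) (bottomKey b))
    total = isTotalOrder-on bottomKey ≈Q⇒bottomKey≋ bottomKey≋⇒≈Q
              (Lex-isTotalOrder Finₚ._≟_ (Flip.isTotalOrder isTotalOrder))
    extends′ : ∀ {a b} → a ≤Q′ b → Lex (flip _⊑ᴸ_) (bottomKey a) (bottomKey b)
    extends′ {a@(inj₁ _)} {b@(inj₁ _)} a≈b               = IsTotalOrder.reflexive total {a} {b} a≈b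
    extends′ {a@(inj₂ _)} {b@(inj₂ _)} a≈b               = IsTotalOrder.reflexive total {a} {b} a≈b
    extends′ {inj₁ _} {inj₂ _} (inj₂ refl)               = inj₂ (refl , inj₁ (z≤n , λ ()))
    extends′ {inj₁ _} {inj₂ (_ , (y<x , _))} (inj₁ refl) = inj₁ (extends (proj₁ y<x) , proj₂ y<x ∘ sym)

  module _ (po : IsPartialOrder _≡_ _≤P_) where

    open IsPartialOrder po using (antisym) renaming (trans to ≤-trans)

    covered-interval : ∀ {x y v} → Covers _≤P_ x y → y ≤P v → v ≤P x → v ≡ x ⊎ v ≡ y
    covered-interval {x} {y} {v} (_ , nothing-between) y≤v v≤x with v Finₚ.≟ x | v Finₚ.≟ y
    ... | yes v≡x | _       = inj₁ v≡x
    ... | no _    | yes v≡y = inj₂ v≡y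
    ... | no v≢x  | no v≢y  = ⊥-elim (nothing-between (v , (y≤v , v≢y ∘ sym) , (v≤x , v≢x)))

    module _ {d : ℕ} (L : Vector (LinearExtension _≡_ _≤P_) d)
             (realizesP : ∀ x y → (∀ i → _⊑_ (L i) x y) → x ≤P y) where

      top-monotone : ∀ {a b} → (∀ i → _⊑_ (byTop (L i)) a b) → top a ≤P top b
      top-monotone h = realizesP _ _ λ i →
        Lex-head {R = _⊑_ (L i)} (IsTotalOrder.refl (LinearExtension.isTotalOrder (L i))) (h i)

      bottom-antitone : ∀ {a b} → (∀ i → _⊑_ (byBottom (L i)) a b) → bottom b ≤P bottom a
      bottom-antitone h = realizesP _ _ λ i →
        Lex-head {R = flip (_⊑_ (L i))} (IsTotalOrder.refl (LinearExtension.isTotalOrder (L i))) (h i)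

      nested-intervals⇒≤Q : ∀ a b → top a ≤P top b → bottom b ≤P bottom a →
                            (∀ i → _⊑_ (byBottom (L i)) a b) → a ≤Q′ b
      nested-intervals⇒≤Q (inj₁ _) (inj₁ _) v≤w w≤v _ = antisym v≤w w≤v
      nested-intervals⇒≤Q (inj₁ _) (inj₂ (_ , c)) v≤x y≤v _ = covered-interval c y≤v v≤x
      nested-intervals⇒≤Q (inj₂ (_ , ((y≤x , y≢x) , _))) (inj₁ _) x≤v v≤y _ =
        ⊥-elim (y≢x (antisym y≤x (≤-trans x≤v v≤y)))
      -- y′ ≤ y < x ≤ x′ with x′ covering y′ forces y = y′, and then byBottom compares the tops.
      nested-intervals⇒≤Q (inj₂ ((x , _) , ((y≤x , y≢x) , _))) (inj₂ ((x′ , _) , c′)) x≤x′ y′≤y h′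
        with covered-interval c′ y′≤y (≤-trans y≤x x≤x′)
      ... | inj₁ refl = ⊥-elim (y≢x (antisym y≤x x≤x′))
      ... | inj₂ refl = antisym x≤x′ x′≤x , refl
        where
        x′≤x : x′ ≤P x
        x′≤x = realizesP _ _ λ i → Lex-last {R = flip (_⊑_ (L i))} (h′ i)

      ⊑-everywhere⇒≤Q : ∀ a b → (∀ i → _⊑_ (byTop (L i)) a b) →
                        (∀ i → _⊑_ (byBottom (L i)) a b) → a ≤Q′ b
      ⊑-everywhere⇒≤Q a b h h′ =
        nested-intervals⇒≤Q a b (top-monotone {a} {b} h) (bottom-antitone {a} {b} h′) h′

lemma3p1 : (n : ℕ) (_≤P_ : Rel (Fin n) 0ℓ) → IsPartialOrder _≡_ _≤P_ →
           (dP dQ : ℕ) → IsDimension _≡_ _≤P_ dP →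
           IsDimension (_≈Q_ _≤P_) (_≤Q_ _≤P_) dQ → dQ ≤ 2 * dP
lemma3p1 n _≤P_ po dP dQ ((L , realizesP) , _) (_ , minimalQ) =
  minimalQ (2 * dP)
    (Realizer-++ (byTop ∘ L) (byBottom ∘ L) (⊑-everywhere⇒≤Q po L realizesP))
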